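{- Let $T\in\mathcal{M}$ be a tree with $b(T)$ square-vertices. Then $F(T)=5b(T)+3$.
   Context: The set $\mathcal{M}$: an element $M\in\mathcal{M}$ is a connected graph made of (i) square-vertices: cycles of length four whose edges ("inner edges") are colored alternately $1,2,1,2$ and whose vertices are called inner vertices; (ii) black vertices of arbitrary finite degree, each equipped with a cyclic ordering of its incident edges; (iii) edges (distinct from inner edges), each joining a black vertex to an inner vertex, such that every inner vertex is incident to exactly one such edge. For $c\in\{1,2\}$, $M^{(c)}$ is the combinatorial map obtained from $M$ by deleting all inner edges of the color other than $c$, then erasing each (now bivalent) inner vertex and merging its edge with its inner edge; its vertices are the black vertices of $M$ with the induced cyclic orders. Faces of $M^{(c)}$ are the usual faces of a combinatorial map (an isolated vertex has one face). $F(M)$ is the number of faces of $M^{(1)}$ plus the number of faces of $M^{(2)}$ plus the number of black vertices of $M$. $M$ is a tree if all its edges (not inner edges) are bridges, equivalently if the graph obtained by replacing each square-vertex by a single ordinary vertex of degree four is a tree. -}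

module Defs where

open import Data.Nat using (ℕ; zero; suc; _+_; _*_; _≤ᵇ_)
open import Data.Bool using (Bool; true; false; not; if_then_else_; _∧_)
open import Data.Fin using (Fin; toℕ; _≟_)
open import Data.List using (List; allFin; upTo; cartesianProduct; foldr)
open import Data.Product using (_×_; _,_; proj₁; Σ; ∃)
open import Data.Sum using (_⊎_; inj₁; inj₂)
open import Data.Unit using (⊤)
open import Function.Bundles using (_↔_; Inverse)
open import Relation.Binary.PropositionalEquality using (_≡_; _≢_)
open import Relation.Binary.Construct.Closure.ReflexiveTransitive using (Star)
open import Relation.Nullary using (¬_)
open import Relation.Nullary.Decidable using (⌊_⌋)

all : {A : Set} → (A → Bool) → List A → Bool
all p = foldr (λ x r → p x ∧ r) true

iter : {A : Set} → (A → A) → ℕ → A → A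
iter f zero    x = x
iter f (suc k) x = f (iter f k x)

-- Darts (= edges of M = inner vertices): inner vertex i ∈ Fin 4 of square-vertex s ∈ Fin b.
-- The four inner vertices of square s are cyclically 0,1,2,3; inner edges of color 1 are
-- {0,1},{2,3}, inner edges of color 2 are {1,2},{3,0} (colored alternately 1,2,1,2).
Dart : ℕ → Set
Dart b = Fin b × Fin 4

darts : (b : ℕ) → List (Dart b)
darts b = cartesianProduct (allFin b) (allFin 4)

pair₁ : Fin 4 → Fin 4
pair₁ Fin.zero = Fin.suc Fin.zero
pair₁ (Fin.suc Fin.zero) = Fin.zero
pair₁ (Fin.suc (Fin.suc Fin.zero)) = Fin.suc (Fin.suc (Fin.suc Fin.zero))
pair₁ (Fin.suc (Fin.suc (Fin.suc Fin.zero))) = Fin.suc (Fin.suc Fin.zero)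

pair₂ : Fin 4 → Fin 4
pair₂ Fin.zero = Fin.suc (Fin.suc (Fin.suc Fin.zero))
pair₂ (Fin.suc Fin.zero) = Fin.suc (Fin.suc Fin.zero)
pair₂ (Fin.suc (Fin.suc Fin.zero)) = Fin.suc Fin.zero
pair₂ (Fin.suc (Fin.suc (Fin.suc Fin.zero))) = Fin.zero

data Color : Set where
  c1 c2 : Color

-- the edge involution of M^(c) on darts
α : {b : ℕ} → Color → Dart b → Dart b
α c1 (s , i) = s , pair₁ i
α c2 (s , i) = s , pair₂ i

-- Graph obtained from M by replacing each square-vertex by a single vertex:
-- vertex set (black vertices) ⊎ (square-vertices); dart d = (s , i) is an edge between
-- black vertex (end d) and square s.  `ok` selects the edges that are kept.
module _ {nV b : ℕ} (end : Dart b → Fin nV) (ok : Dart b → Set) where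
  Adj : (Fin nV ⊎ Fin b) → (Fin nV ⊎ Fin b) → Set
  Adj x y = Σ (Dart b) λ d → ok d ×
              ((x ≡ inj₁ (end d) × y ≡ inj₂ (proj₁ d)) ⊎ (x ≡ inj₂ (proj₁ d) × y ≡ inj₁ (end d)))

  Connected : Set
  Connected = (Fin nV ⊎ Fin b) × (∀ x y → Star Adj x y)

record SquareMap : Set where
  field
    nV  : ℕ                      -- number of black vertices
    b   : ℕ
    end : Dart b → Fin nV        -- black endpoint of the edge at each inner vertex
    σ   : Dart b ↔ Dart b        -- cyclic orderings around black vertices
    σ-preserves : ∀ d → end (Inverse.to σ d) ≡ end d
    σ-cyclic    : ∀ d d' → end d ≡ end d' → ∃ λ k → iter (Inverse.to σ) k d ≡ d'
    connected   : Connected end (λ _ → ⊤)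

  IsTree : Set
  IsTree = ∀ e → ¬ Connected end (λ d → d ≢ e)

  rank : Dart b → ℕ
  rank (s , i) = toℕ s * 4 + toℕ i

  count : {A : Set} → (A → Bool) → List A → ℕ
  count p = foldr (λ x n → if p x then suc n else n) 0

  -- number of cycles of a permutation f of the darts: count the darts that are
  -- minimal (w.r.t. rank) in their orbit {f^k d | k < 4b}
  cycles : (Dart b → Dart b) → ℕ
  cycles f = count (λ d → all (λ k → rank d ≤ᵇ rank (iter f k d)) (upTo (b * 4))) (darts b)

  isolated : ℕ
  isolated = count (λ v → all (λ d → not ⌊ end d ≟ v ⌋) (darts b)) (allFin nV)

  -- faces of M^(c): cycles of the face permutation σ ∘ α_c, plus one per isolated vertex
  faces : Color → ℕ
  faces c = cycles (λ d → Inverse.to σ (α c d)) + isolated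

  F : ℕ
  F = faces c1 + faces c2 + nV

module Submission where

-- Darts are the inner vertices; `next` (the permutation σ of Defs) is the vertex permutation and
-- the faces of M^(c) are the cycles of next ∘ α c, where α c is the product of the 2b
-- transpositions along the inner edges of color c.  Composing a permutation with a transposition
-- of two points on distinct cycles merges these cycles.  In a tree, transpositions inside squares
-- always join distinct cycles (otherwise some edge would not be a bridge), so
--   #faces(M^(c)) = V − 2b + iso   for c = 1, 2,
-- where V = #cycles(next) and iso = #isolated vertices.  Twisting next by the 3b transpositions of
-- a spanning star in every square gives, again in a tree, V − 3b cycles; by connectivity this is a
-- single cycle (or none, when b = 0 and there is one isolated vertex), so V − 3b + iso = 1.
-- Finally the black vertices number V + iso, and F(T) = 3 (V − 3b + iso) + 5b = 5b + 3.

open import Algebra.Properties.CommutativeSemigroup using (interchange)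
open import Defs
open import Data.Bool using (Bool; true; false; not; _∧_; if_then_else_)
open import Data.Bool.Properties using (T-≡; ∧-zeroʳ)
open import Data.Empty using (⊥; ⊥-elim)
open import Data.Fin as Fin using (Fin; toℕ; fromℕ<)
import Data.Fin.Properties as Finₚ
open import Data.List using (List; []; _∷_; _++_; length; foldr; upTo; allFin; concatMap)
import Data.List.Properties as Listₚ
open import Data.List.Membership.Propositional using (_∈_)
open import Data.List.Membership.Propositional.Properties
  using (∈-upTo⁺; ∈-allFin; ∈-cartesianProduct⁺; ∈-concatMap⁺)
open import Data.List.Relation.Unary.All as All using (All; []; _∷_)
open import Data.List.Relation.Unary.All.Properties using (++⁺)
open import Data.List.Relation.Unary.Any as Any using (here; there)
open import Data.List.Relation.Unary.AllPairs using ([]; _∷_)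
open import Data.List.Relation.Unary.Unique.Propositional using (Unique)
open import Data.List.Relation.Unary.Unique.Propositional.Properties using (allFin⁺; cartesianProduct⁺)
open import Data.Nat using (ℕ; zero; suc; _+_; _*_; _∸_; _≤_; _<_; _≤ᵇ_; z≤n; s≤s⁻¹; _≤?_)
open import Data.Nat.Properties
open import Data.Nat.Solver using (module +-*-Solver)
open import Data.Nat.DivMod using (_%_; _/_; m≡m%n+[m/n]*n; m%n<n)
open import Data.Product using (_×_; _,_; proj₁; proj₂; ∃)
open import Data.Product.Properties using (≡-dec)
open import Data.Sum using (_⊎_; inj₁; inj₂; [_,_]′)
open import Data.Unit using (⊤)
open import Function using (_∘_; id; Equivalence)
open import Function.Bundles using (Inverse)
open import Relation.Binary.Definitions using (DecidableEquality; tri<; tri≈; tri>)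
open import Relation.Binary.PropositionalEquality
open import Relation.Binary.Construct.Closure.ReflexiveTransitive as Star using (Star; ε; _◅_; _◅◅_)
open import Relation.Nullary using (¬_; Dec; yes; no)
open import Relation.Nullary.Decidable using (⌊_⌋; isYes≗does; dec-true; dec-false)

module _ {A : Set} (f : A → A) where

  iter-+ : ∀ m n x → iter f (m + n) x ≡ iter f m (iter f n x)
  iter-+ zero    n x = refl
  iter-+ (suc m) n x = cong f (iter-+ m n x)

  iter-* : ∀ {p x} → iter f p x ≡ x → ∀ q → iter f (q * p) x ≡ x
  iter-* fix zero = refl
  iter-* {p} {x} fix (suc q) = begin
    iter f (p + q * p) x        ≡⟨ iter-+ p (q * p) x ⟩
    iter f p (iter f (q * p) x) ≡⟨ cong (iter f p) (iter-* fix q) ⟩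
    iter f p x                  ≡⟨ fix ⟩
    x                           ∎
    where open ≡-Reasoning

  iter-injective : (∀ {x y} → f x ≡ f y → x ≡ y) → ∀ k {x y} → iter f k x ≡ iter f k y → x ≡ y
  iter-injective inj zero    e = e
  iter-injective inj (suc k) e = iter-injective inj k (inj e)

iter-cong : ∀ {A : Set} {f g : A → A} → (∀ x → f x ≡ g x) → ∀ k x → iter f k x ≡ iter g k x
iter-cong e zero    x = refl
iter-cong {f = f} e (suc k) x = trans (cong f (iter-cong e k x)) (e _)

count : {A : Set} → (A → Bool) → List A → ℕ
count p = foldr (λ x n → if p x then suc n else n) 0

module _ {A : Set} where

  count-cong : {p q : A → Bool} (xs : List A) → (∀ {x} → x ∈ xs → p x ≡ q x) → count p xs ≡ count q xs
  count-cong [] e = refl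
  count-cong (x ∷ xs) e rewrite e (here refl) | count-cong xs (e ∘ there) = refl

  count-none : {p : A → Bool} (xs : List A) → (∀ {x} → x ∈ xs → p x ≡ false) → count p xs ≡ 0
  count-none [] h = refl
  count-none (x ∷ xs) h rewrite h (here refl) = count-none xs (h ∘ there)

  count-all : {p : A → Bool} (xs : List A) → (∀ {x} → x ∈ xs → p x ≡ true) → count p xs ≡ length xs
  count-all [] h = refl
  count-all (x ∷ xs) h rewrite h (here refl) = cong suc (count-all xs (h ∘ there))

  count-drop : {p q : A → Bool} (xs : List A) → Unique xs → ∀ {e} → e ∈ xs →
    p e ≡ true → q e ≡ false → (∀ x → x ≢ e → p x ≡ q x) → count p xs ≡ suc (count q xs)
  count-drop (x ∷ xs) (x∉xs ∷ _) (here refl) pe qe elsewhere rewrite pe | qe =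
    cong suc (count-cong xs λ m → elsewhere _ λ { refl → All.lookup x∉xs m refl })
  count-drop {q = q} (x ∷ xs) (x∉xs ∷ u) {e} (there m) pe qe elsewhere
    rewrite elsewhere x (λ { refl → All.lookup x∉xs m refl }) with q x
  ... | true  = cong suc (count-drop xs u m pe qe elsewhere)
  ... | false = count-drop xs u m pe qe elsewhere

  count-one : {p : A → Bool} (xs : List A) → Unique xs → ∀ {e} → e ∈ xs →
    p e ≡ true → (∀ x → x ≢ e → p x ≡ false) → count p xs ≡ 1
  count-one xs u m pe elsewhere =
    trans (count-drop {q = λ _ → false} xs u m pe refl elsewhere) (cong suc (count-none xs (λ _ → refl)))

  all-sound : (p : A → Bool) (xs : List A) → all p xs ≡ true → ∀ {x} → x ∈ xs → p x ≡ true
  all-sound p (y ∷ xs) h m with p y in py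
  all-sound p (y ∷ xs) h (here refl) | true = py
  all-sound p (y ∷ xs) h (there m)   | true = all-sound p xs h m

  all-complete : (p : A → Bool) (xs : List A) → (∀ {x} → x ∈ xs → p x ≡ true) → all p xs ≡ true
  all-complete p [] h = refl
  all-complete p (y ∷ xs) h rewrite h (here refl) = all-complete p xs (h ∘ there)

  all-refute : (p : A → Bool) (xs : List A) → ∀ {x} → x ∈ xs → p x ≡ false → all p xs ≡ false
  all-refute p (y ∷ xs) (here refl) px rewrite px = refl
  all-refute p (y ∷ xs) (there m) px with p y
  ... | true  = all-refute p xs m px
  ... | false = refl

  all-witness : (p : A → Bool) (xs : List A) → all p xs ≡ false → ∃ λ x → x ∈ xs × p x ≡ false
  all-witness p (y ∷ xs) h with p y in py
  ... | true  = let (x , m , px) = all-witness p xs h in x , there m , px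
  ... | false = y , here refl , py

  all-cong : {p q : A → Bool} (xs : List A) → (∀ x → p x ≡ q x) → all p xs ≡ all q xs
  all-cong [] e = refl
  all-cong (x ∷ xs) e rewrite e x | all-cong xs e = refl

bool-ext : {p q : Bool} → (p ≡ true → q ≡ true) → (q ≡ true → p ≡ true) → p ≡ q
bool-ext {false} {false} _ _ = refl
bool-ext {false} {true}  _ g = g refl
bool-ext {true}  {false} f _ = sym (f refl)
bool-ext {true}  {true}  _ _ = refl

⌊⌋-true : ∀ {P : Set} (d : Dec P) → P → ⌊ d ⌋ ≡ true
⌊⌋-true d p = trans (isYes≗does d) (dec-true d p)

⌊⌋-false : ∀ {P : Set} (d : Dec P) → ¬ P → ⌊ d ⌋ ≡ false
⌊⌋-false d ¬p = trans (isYes≗does d) (dec-false d ¬p)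

≤ᵇ-sound : ∀ {m n} → (m ≤ᵇ n) ≡ true → m ≤ n
≤ᵇ-sound {m} {n} e = ≤ᵇ⇒≤ m n (Equivalence.from T-≡ e)

≤ᵇ-complete : ∀ {m n} → m ≤ n → (m ≤ᵇ n) ≡ true
≤ᵇ-complete p = Equivalence.to T-≡ (≤⇒≤ᵇ p)

sum : {A : Set} → (A → ℕ) → List A → ℕ
sum f = foldr (λ x n → f x + n) 0

indicator : Bool → ℕ
indicator true  = 1
indicator false = 0

module _ {A : Set} where

  sum-cong : {f g : A → ℕ} (xs : List A) → (∀ x → f x ≡ g x) → sum f xs ≡ sum g xs
  sum-cong [] e = refl
  sum-cong (x ∷ xs) e = cong₂ _+_ (e x) (sum-cong xs e)

  sum-+ : (f g : A → ℕ) (xs : List A) → sum (λ x → f x + g x) xs ≡ sum f xs + sum g xs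
  sum-+ f g [] = refl
  sum-+ f g (x ∷ xs) = begin
    f x + g x + sum (λ x → f x + g x) xs ≡⟨ cong (f x + g x +_) (sum-+ f g xs) ⟩
    f x + g x + (sum f xs + sum g xs)   ≡⟨ interchange +-commutativeSemigroup (f x) (g x) (sum f xs) (sum g xs) ⟩
    f x + sum f xs + (g x + sum g xs)   ∎
    where open ≡-Reasoning

  sum-zero : (xs : List A) → sum (λ _ → 0) xs ≡ 0
  sum-zero [] = refl
  sum-zero (x ∷ xs) = sum-zero xs

  sum-const-1 : (xs : List A) → sum (λ _ → 1) xs ≡ length xs
  sum-const-1 [] = refl
  sum-const-1 (x ∷ xs) = cong suc (sum-const-1 xs)

  count-as-sum : (p : A → Bool) (xs : List A) → count p xs ≡ sum (indicator ∘ p) xs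
  count-as-sum p [] = refl
  count-as-sum p (x ∷ xs) with p x
  ... | true  = cong suc (count-as-sum p xs)
  ... | false = count-as-sum p xs

count-fibres : ∀ {A : Set} {n} (h : A → Fin n) (p : A → Bool) (xs : List A) →
  count p xs ≡ sum (λ v → count (λ x → p x ∧ ⌊ h x Fin.≟ v ⌋) xs) (allFin n)
count-fibres {n = n} h p [] = sym (sum-zero (allFin n))
count-fibres {A} {n} h p (x ∷ xs) = begin
  count p (x ∷ xs)
    ≡⟨ head-and-tail p ⟩
  indicator (p x) + count p xs
    ≡⟨ cong₂ _+_ (sym (fibre-of-x (p x) refl)) (count-fibres h p xs) ⟩
  sum (λ v → indicator (p x ∧ hit v)) (allFin n) + sum (λ v → count (λ y → p y ∧ ⌊ h y Fin.≟ v ⌋) xs) (allFin n)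
    ≡⟨ sum-+ _ _ (allFin n) ⟨
  sum (λ v → indicator (p x ∧ hit v) + count (λ y → p y ∧ ⌊ h y Fin.≟ v ⌋) xs) (allFin n)
    ≡⟨ sum-cong (allFin n) (λ v → sym (head-and-tail (λ y → p y ∧ ⌊ h y Fin.≟ v ⌋))) ⟩
  sum (λ v → count (λ y → p y ∧ ⌊ h y Fin.≟ v ⌋) (x ∷ xs)) (allFin n)
    ∎
  where
  open ≡-Reasoning
  hit : Fin n → Bool
  hit v = ⌊ h x Fin.≟ v ⌋
  head-and-tail : (q : A → Bool) → count q (x ∷ xs) ≡ indicator (q x) + count q xs
  head-and-tail q with q x
  ... | true  = refl
  ... | false = refl
  fibre-of-x : (c : Bool) → p x ≡ c → sum (λ v → indicator (p x ∧ hit v)) (allFin n) ≡ indicator (p x)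
  fibre-of-x false px rewrite px = sum-zero (allFin n)
  fibre-of-x true  px rewrite px = trans (sym (count-as-sum hit (allFin n)))
    (count-one (allFin n) (allFin⁺ n) (∈-allFin (h x)) (⌊⌋-true (h x Fin.≟ h x) refl)
               (λ v v≢hx → ⌊⌋-false (h x Fin.≟ v) (v≢hx ∘ sym)))

-- Cycles of permutations of a finite set
--
-- A permutation is presented as an injective self-map; its cycles are counted as in
-- Defs, by the elements that are rank-minimal among their first N iterates.

module Permutations {A : Set} (_≟_ : DecidableEquality A)
    (elems : List A) (elems-unique : Unique elems) (elems-complete : ∀ x → x ∈ elems)
    (N : ℕ) (rank : A → ℕ) (rank-injective : ∀ {x y} → rank x ≡ rank y → x ≡ y)
    (rank<N : ∀ x → rank x < N) where

  Injective : (A → A) → Set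
  Injective f = ∀ {x y} → f x ≡ f y → x ≡ y

  Orbit : (A → A) → A → A → Set
  Orbit f x y = ∃ λ k → iter f k x ≡ y

  isMin? : (A → A) → A → Bool
  isMin? f x = all (λ k → rank x ≤ᵇ rank (iter f k x)) (upTo N)

  cycles : (A → A) → ℕ
  cycles f = count (isMin? f) elems

  cycles-cong : ∀ {f g} → (∀ x → f x ≡ g x) → cycles f ≡ cycles g
  cycles-cong e = count-cong elems λ {x} _ →
    all-cong (upTo N) (λ k → cong (λ y → rank x ≤ᵇ rank y) (iter-cong e k x))

  orbit-refl : ∀ {f x} → Orbit f x x
  orbit-refl = 0 , refl

  orbit-trans : ∀ {f x y z} → Orbit f x y → Orbit f y z → Orbit f x z
  orbit-trans {f} {x} (k , refl) (l , refl) = l + k , iter-+ f l k x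

  orbit-step : ∀ {f x y} → Orbit f x y → Orbit f x (f y)
  orbit-step (k , refl) = suc k , refl

  module Orbits {f : A → A} (f-inj : Injective f) where

    -- by pigeonhole on ranks, some f^(p+1) with p+1 ≤ N fixes x
    period : ∀ x → ∃ λ p → iter f (suc p) x ≡ x × suc p ≤ N
    period x with Finₚ.pigeonhole (n<1+n N) (λ i → fromℕ< (rank<N (iter f (toℕ i) x)))
    ... | i , j , i<j , same-rank = p , fixed , bounded
      where
      collide : iter f (toℕ i) x ≡ iter f (toℕ j) x
      collide = rank-injective (begin
        rank (iter f (toℕ i) x)                           ≡⟨ Finₚ.toℕ-fromℕ< _ ⟨
        toℕ (fromℕ< (rank<N (iter f (toℕ i) x)))          ≡⟨ cong toℕ same-rank ⟩
        toℕ (fromℕ< (rank<N (iter f (toℕ j) x)))          ≡⟨ Finₚ.toℕ-fromℕ< _ ⟩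
        rank (iter f (toℕ j) x)                           ∎)
        where open ≡-Reasoning
      fixed′ : iter f (toℕ j ∸ toℕ i) x ≡ x
      fixed′ = iter-injective f f-inj (toℕ i) (begin
        iter f (toℕ i) (iter f (toℕ j ∸ toℕ i) x) ≡⟨ iter-+ f (toℕ i) _ x ⟨
        iter f (toℕ i + (toℕ j ∸ toℕ i)) x        ≡⟨ cong (λ k → iter f k x) (m+[n∸m]≡n (<⇒≤ i<j)) ⟩
        iter f (toℕ j) x                          ≡⟨ collide ⟨
        iter f (toℕ i) x                          ∎)
        where open ≡-Reasoning
      gap : ∃ λ p → toℕ j ∸ toℕ i ≡ suc p
      gap with toℕ j ∸ toℕ i | m<n⇒0<n∸m i<j
      ... | suc p | _ = p , refl
      p : ℕ
      p = proj₁ gap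
      fixed : iter f (suc p) x ≡ x
      fixed = subst (λ k → iter f k x ≡ x) (proj₂ gap) fixed′
      bounded : suc p ≤ N
      bounded = subst (_≤ N) (proj₂ gap) (≤-trans (m∸n≤m (toℕ j) (toℕ i)) (s≤s⁻¹ (Finₚ.toℕ<n j)))

    orbit-bounded : ∀ {x y} → Orbit f x y → ∃ λ k → k < N × iter f k x ≡ y
    orbit-bounded {x} (k , refl) with period x
    ... | p , fixed , bounded =
      k % suc p , ≤-trans (m%n<n k (suc p)) bounded , sym (begin
        iter f k x                                        ≡⟨ cong (λ n → iter f n x) (m≡m%n+[m/n]*n k (suc p)) ⟩
        iter f (k % suc p + k / suc p * suc p) x          ≡⟨ iter-+ f (k % suc p) _ x ⟩
        iter f (k % suc p) (iter f (k / suc p * suc p) x) ≡⟨ cong (iter f (k % suc p)) (iter-* f fixed (k / suc p)) ⟩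
        iter f (k % suc p) x                              ∎)
      where open ≡-Reasoning

    -- orbits of a permutation are symmetric: go round the cycle the rest of the way
    orbit-sym : ∀ {x y} → Orbit f x y → Orbit f y x
    orbit-sym {x} (k , refl) with period x
    ... | p , fixed , _ = k * suc p ∸ k , (begin
      iter f (k * suc p ∸ k) (iter f k x) ≡⟨ iter-+ f (k * suc p ∸ k) k x ⟨
      iter f (k * suc p ∸ k + k) x        ≡⟨ cong (λ n → iter f n x) (m∸n+n≡m (m≤m*n k (suc p))) ⟩
      iter f (k * suc p) x                ≡⟨ iter-* f fixed k ⟩
      x                                   ∎)
      where open ≡-Reasoning

    orbit? : ∀ x y → Dec (Orbit f x y)
    orbit? x y with Finₚ.any? (λ (i : Fin N) → iter f (toℕ i) x ≟ y)
    ... | yes (i , e) = yes (toℕ i , e)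
    ... | no none = no λ o → let (k , k<N , e) = orbit-bounded o in
            none (fromℕ< k<N , trans (cong (λ n → iter f n x) (Finₚ.toℕ-fromℕ< k<N)) e)

    IsMin : A → Set
    IsMin x = ∀ y → Orbit f x y → rank x ≤ rank y

    isMin?-sound : ∀ x → isMin? f x ≡ true → IsMin x
    isMin?-sound x h y o with orbit-bounded o
    ... | k , k<N , refl = ≤ᵇ-sound (all-sound _ (upTo N) h (∈-upTo⁺ k<N))

    isMin?-complete : ∀ x → IsMin x → isMin? f x ≡ true
    isMin?-complete x h = all-complete _ (upTo N) (λ {k} _ → ≤ᵇ-complete (h _ (k , refl)))

    min-unique : ∀ {u v} → IsMin u → IsMin v → Orbit f u v → u ≡ v
    min-unique hu hv o = rank-injective (≤-antisym (hu _ o) (hv _ (orbit-sym o)))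

    min-of-iterates : ∀ x n → ∃ λ m → Orbit f x m × (∀ k → k ≤ n → rank m ≤ rank (iter f k x))
    min-of-iterates x zero = x , orbit-refl , λ { k z≤n → ≤-refl }
    min-of-iterates x (suc n) with min-of-iterates x n
    ... | m , o , least with rank m ≤? rank (iter f (suc n) x)
    ... | yes m≤ = m , o , λ k k≤ → [ (λ k<n → least k (s≤s⁻¹ k<n)) , (λ { refl → m≤ }) ]′ (m≤n⇒m<n∨m≡n k≤)
    ... | no m≰ = iter f (suc n) x , (suc n , refl) ,
          λ k k≤ → [ (λ k<n → ≤-trans (<⇒≤ (≰⇒> m≰)) (least k (s≤s⁻¹ k<n))) , (λ { refl → ≤-refl }) ]′ (m≤n⇒m<n∨m≡n k≤)

    orbit-min : ∀ x → ∃ λ m → Orbit f x m × IsMin m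
    orbit-min x with min-of-iterates x N
    ... | m , o , least = m , o , λ y o′ →
      let (k , k<N , e) = orbit-bounded (orbit-trans o o′) in subst (λ z → rank m ≤ rank z) e (least k (<⇒≤ k<N))

    cycles-transitive : (∀ x y → Orbit f x y) → A → cycles f ≡ 1
    cycles-transitive all-joined x with orbit-min x
    ... | m , _ , m-min = count-one elems elems-unique (elems-complete m) (isMin?-complete m m-min) others
      where
      others : ∀ y → y ≢ m → isMin? f y ≡ false
      others y y≢m with isMin? f y in h
      ... | false = refl
      ... | true  = ⊥-elim (y≢m (min-unique (isMin?-sound y h) m-min (all-joined y m)))

  swap : A → A → A → A
  swap a b x with x ≟ a
  ... | yes _ = b
  ... | no _ with x ≟ b
  ... | yes _ = a
  ... | no _  = x

  swap-left : ∀ a b → swap a b a ≡ b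
  swap-left a b with a ≟ a
  ... | yes _ = refl
  ... | no ne = ⊥-elim (ne refl)

  swap-right : ∀ a b → swap a b b ≡ a
  swap-right a b with b ≟ a
  ... | yes refl = refl
  ... | no _ with b ≟ b
  ... | yes _ = refl
  ... | no ne = ⊥-elim (ne refl)

  swap-other : ∀ a b x → x ≢ a → x ≢ b → swap a b x ≡ x
  swap-other a b x x≢a x≢b with x ≟ a
  ... | yes e = ⊥-elim (x≢a e)
  ... | no _ with x ≟ b
  ... | yes e = ⊥-elim (x≢b e)
  ... | no _  = refl

  swap-cases : ∀ a b x → (x ≡ a × swap a b x ≡ b) ⊎ (x ≡ b × swap a b x ≡ a) ⊎ (swap a b x ≡ x)
  swap-cases a b x with x ≟ a
  ... | yes x≡a = inj₁ (x≡a , refl)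
  ... | no _ with x ≟ b
  ... | yes x≡b = inj₂ (inj₁ (x≡b , refl))
  ... | no _    = inj₂ (inj₂ refl)

  swap-comm : ∀ a b x → swap a b x ≡ swap b a x
  swap-comm a b x = by-cases (x ≟ a) (x ≟ b)
    where
    by-cases : Dec (x ≡ a) → Dec (x ≡ b) → swap a b x ≡ swap b a x
    by-cases (yes refl) (yes refl) = refl
    by-cases (yes refl) (no _)     = trans (swap-left x b) (sym (swap-right b x))
    by-cases (no _)     (yes refl) = trans (swap-right a x) (sym (swap-left x a))
    by-cases (no x≢a)   (no x≢b)   = trans (swap-other a b x x≢a x≢b) (sym (swap-other b a x x≢b x≢a))

  swap-involutive : ∀ a b x → swap a b (swap a b x) ≡ x
  swap-involutive a b x with swap-cases a b x
  ... | inj₁ (refl , e)        = trans (cong (swap x b) e) (swap-right x b)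
  ... | inj₂ (inj₁ (refl , e)) = trans (cong (swap a x) e) (swap-left a x)
  ... | inj₂ (inj₂ e)          = trans (cong (swap a b) e) e

  swap-injective : ∀ a b → Injective (swap a b)
  swap-injective a b {x} {y} e =
    trans (sym (swap-involutive a b x)) (trans (cong (swap a b) e) (swap-involutive a b y))

  -- If a does not reach b under f, then under g = f ∘ (a b) the point a reaches all of the
  -- f-orbit of b: g a = f b, and from there g follows f around that orbit until it comes back to b.
  swap-reach : ∀ {f g a b} → Injective f → ¬ Orbit f a b → (∀ x → g x ≡ f (swap a b x)) →
               ∀ {y} → Orbit f b y → Orbit g a y
  swap-reach {f} {g} {a} {b} f-inj a↛b g-def b→y with orbit-trans (Orbits.orbit-sym f-inj (1 , refl)) b→y
  ... | k , refl = along k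
    where
    ga : g a ≡ f b
    ga = trans (g-def a) (cong f (swap-left a b))
    along : ∀ k → Orbit g a (iter f k (f b))
    along zero = 1 , ga
    along (suc k) with swap-cases a b (iter f k (f b))
    ... | inj₁ (is-a , _) = ⊥-elim (a↛b (Orbits.orbit-sym f-inj (k + 1 , trans (iter-+ f k 1 b) is-a)))
    ... | inj₂ (inj₁ (is-b , _)) = subst (λ z → Orbit g a (f z)) (sym is-b) (1 , ga)
    ... | inj₂ (inj₂ fixed) = subst (Orbit g a) (trans (g-def _) (cong f fixed)) (orbit-step (along k))

  module Merge {f : A → A} (f-inj : Injective f) {a b : A} (a↛b : ¬ Orbit f a b) where

    g : A → A
    g = f ∘ swap a b

    g-inj : Injective g
    g-inj e = swap-injective a b (f-inj e)

    private
      module F = Orbits f-inj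
      module G = Orbits g-inj

    Merged : A → Set
    Merged x = Orbit f a x ⊎ Orbit f b x

    merged-reached : ∀ {y} → Merged y → Orbit g a y
    merged-reached (inj₂ b→y) = swap-reach f-inj a↛b (λ _ → refl) b→y
    merged-reached (inj₁ a→y) = orbit-trans (merged-reached (inj₂ orbit-refl))
      (swap-reach f-inj (a↛b ∘ F.orbit-sym) (λ x → cong f (swap-comm a b x)) a→y)

    joined : Orbit g a b
    joined = merged-reached (inj₂ orbit-refl)

    merged-closed-f : ∀ {x y} → Merged x → Orbit f x y → Merged y
    merged-closed-f (inj₁ o) o′ = inj₁ (orbit-trans o o′)
    merged-closed-f (inj₂ o) o′ = inj₂ (orbit-trans o o′)

    merged-closed-g : ∀ {x y} → Merged x → Orbit g x y → Merged y
    merged-closed-g mx (zero , refl) = mx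
    merged-closed-g {x} mx (suc k , refl) with merged-closed-g mx (k , refl) | swap-cases a b (iter g k x)
    ... | _  | inj₁ (_ , e)        = merged-closed-f (inj₂ orbit-refl) (1 , cong f (sym e))
    ... | _  | inj₂ (inj₁ (_ , e)) = merged-closed-f (inj₁ orbit-refl) (1 , cong f (sym e))
    ... | my | inj₂ (inj₂ e)       = merged-closed-f my (1 , cong f (sym e))

    unmerged-agree : ∀ {x} → ¬ Merged x → ∀ k → iter g k x ≡ iter f k x
    unmerged-agree nx zero = refl
    unmerged-agree {x} nx (suc k) rewrite unmerged-agree nx k with swap-cases a b (iter f k x)
    ... | inj₁ (e , _)        = ⊥-elim (nx (inj₁ (F.orbit-sym (k , e))))
    ... | inj₂ (inj₁ (e , _)) = ⊥-elim (nx (inj₂ (F.orbit-sym (k , e))))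
    ... | inj₂ (inj₂ e)       = cong f e

    orbit-preserved : ∀ {x y} → Orbit f x y → Orbit g x y
    orbit-preserved {x} {y} o with F.orbit? a x | F.orbit? b x
    ... | yes a→x | _ = orbit-trans (G.orbit-sym (merged-reached (inj₁ a→x))) (merged-reached (merged-closed-f (inj₁ a→x) o))
    ... | no _ | yes b→x = orbit-trans (G.orbit-sym (merged-reached (inj₂ b→x))) (merged-reached (merged-closed-f (inj₂ b→x) o))
    ... | no a↛x | no b↛x with o
    ...   | k , refl = k , unmerged-agree [ a↛x , b↛x ]′ k

    -- Let u and v be the minima of the cycles of a and of b, with u below v.  Then v is the
    -- only point that is minimal for f but not for g.
    module _ {u v} (a→u : Orbit f a u) (u-min : F.IsMin u) (b→v : Orbit f b v) (v-min : F.IsMin v)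
             (u<v : rank u < rank v) where

      u-below-merged : ∀ {y} → Merged y → rank u ≤ rank y
      u-below-merged (inj₁ a→y) = u-min _ (orbit-trans (F.orbit-sym a→u) a→y)
      u-below-merged (inj₂ b→y) = ≤-trans (<⇒≤ u<v) (v-min _ (orbit-trans (F.orbit-sym b→v) b→y))

      min-g⇒min-f : ∀ {x} → G.IsMin x → F.IsMin x
      min-g⇒min-f x-min y o = x-min y (orbit-preserved o)

      min-f⇒min-g : ∀ {x} → x ≢ v → F.IsMin x → G.IsMin x
      min-f⇒min-g {x} x≢v x-min y g-o with F.orbit? a x | F.orbit? b x
      ... | yes a→x | _ = ≤-trans (x-min u (orbit-trans (F.orbit-sym a→x) a→u))
                                  (u-below-merged (merged-closed-g (inj₁ a→x) g-o))
      ... | no _ | yes b→x = ⊥-elim (x≢v (F.min-unique x-min v-min (orbit-trans (F.orbit-sym b→x) b→v)))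
      ... | no a↛x | no b↛x with g-o
      ...   | k , refl = x-min _ (k , sym (unmerged-agree [ a↛x , b↛x ]′ k))

      v-not-min : isMin? g v ≡ false
      v-not-min with isMin? g v in h
      ... | false = refl
      ... | true  = ⊥-elim (<⇒≱ u<v (G.isMin?-sound v h u v→u))
        where
        v→u : Orbit g v u
        v→u = orbit-trans (G.orbit-sym (merged-reached (inj₂ b→v))) (merged-reached (inj₁ a→u))

      merge-count : cycles f ≡ suc (cycles g)
      merge-count = count-drop elems elems-unique (elems-complete v) (F.isMin?-complete v v-min) v-not-min
        λ x x≢v → bool-ext (λ h → G.isMin?-complete x (min-f⇒min-g x≢v (F.isMin?-sound x h)))
                           (λ h → F.isMin?-complete x (min-g⇒min-f (G.isMin?-sound x h)))

  cycles-swap : ∀ {f} → Injective f → ∀ {a b} → ¬ Orbit f a b → cycles f ≡ suc (cycles (f ∘ swap a b))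
  cycles-swap {f} f-inj {a} {b} a↛b with F.orbit-min a | F.orbit-min b
    where module F = Orbits f-inj
  ... | u , a→u , u-min | v , b→v , v-min with <-cmp (rank u) (rank v)
  ... | tri< u<v _ _ = Merge.merge-count f-inj a↛b a→u u-min b→v v-min u<v
  ... | tri≈ _ u≡v _ = ⊥-elim (a↛b (orbit-trans a→u (subst (λ z → Orbit f z b) (rank-injective (sym u≡v))
                                     (Orbits.orbit-sym f-inj b→v))))
  ... | tri> _ _ v<u = trans (Merge.merge-count f-inj (a↛b ∘ Orbits.orbit-sym f-inj) b→v v-min a→u u-min v<u)
                             (cong suc (cycles-cong (λ x → cong f (swap-comm b a x))))

  -- Products of transpositions, applied from the head of the list on.
  transpose : List (A × A) → A → A
  transpose [] x = x
  transpose ((a , c) ∷ ts) x = transpose ts (swap a c x)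

  transpose-++ : ∀ xs ys x → transpose (xs ++ ys) x ≡ transpose ys (transpose xs x)
  transpose-++ [] ys x = refl
  transpose-++ ((a , c) ∷ xs) ys x = transpose-++ xs ys (swap a c x)

  transpose-injective : ∀ ts → Injective (transpose ts)
  transpose-injective [] e = e
  transpose-injective ((a , c) ∷ ts) e = swap-injective a c (transpose-injective ts e)

  Avoids : A → List (A × A) → Set
  Avoids x = All (λ t → proj₁ t ≢ x × proj₂ t ≢ x)

  transpose-fixes : ∀ {x} ts → Avoids x ts → transpose ts x ≡ x
  transpose-fixes [] [] = refl
  transpose-fixes {x} ((a , c) ∷ ts) ((a≢x , c≢x) ∷ avoid) =
    trans (cong (transpose ts) (swap-other a c x (a≢x ∘ sym) (c≢x ∘ sym))) (transpose-fixes ts avoid)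

  module Products (σ : A → A) (σ-inj : Injective σ) where

    twist : List (A × A) → A → A
    twist ts = σ ∘ transpose ts

    twist-inj : ∀ ts → Injective (twist ts)
    twist-inj ts e = transpose-injective ts (σ-inj e)

    data Merging : List (A × A) → Set where
      []  : Merging []
      _∷_ : ∀ {a c ts} → ¬ Orbit (twist ts) a c → Merging ts → Merging ((a , c) ∷ ts)

    cycles-twist : ∀ ts → Merging ts → cycles (twist ts) + length ts ≡ cycles σ
    cycles-twist [] [] = +-identityʳ _
    cycles-twist ((a , c) ∷ ts) (a↛c ∷ m) = begin
      cycles (twist ((a , c) ∷ ts)) + suc (length ts)  ≡⟨ +-suc _ (length ts) ⟩
      suc (cycles (twist ((a , c) ∷ ts))) + length ts  ≡⟨ cong (_+ length ts) (cycles-swap (twist-inj ts) a↛c) ⟨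
      cycles (twist ts) + length ts                    ≡⟨ cycles-twist ts m ⟩
      cycles σ                                         ∎
      where open ≡-Reasoning

    Step : List (A × A) → A → A → Set
    Step ts x y = (y ≡ σ x) ⊎ (x ≡ σ y) ⊎ ((x , y) ∈ ts) ⊎ ((y , x) ∈ ts)

    step-sym : ∀ {ts x y} → Step ts x y → Step ts y x
    step-sym (inj₁ e)               = inj₂ (inj₁ e)
    step-sym (inj₂ (inj₁ e))        = inj₁ e
    step-sym (inj₂ (inj₂ (inj₁ m))) = inj₂ (inj₂ (inj₂ m))
    step-sym (inj₂ (inj₂ (inj₂ m))) = inj₂ (inj₂ (inj₁ m))

    step-weaken : ∀ {t ts x y} → Step ts x y → Step (t ∷ ts) x y
    step-weaken (inj₁ e)               = inj₁ e
    step-weaken (inj₂ (inj₁ e))        = inj₂ (inj₁ e)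
    step-weaken (inj₂ (inj₂ (inj₁ m))) = inj₂ (inj₂ (inj₁ (there m)))
    step-weaken (inj₂ (inj₂ (inj₂ m))) = inj₂ (inj₂ (inj₂ (there m)))

    step-orbit : ∀ ts → Merging ts → ∀ {x y} → Step ts x y → Orbit (twist ts) x y
    step-orbit [] [] (inj₁ refl)        = 1 , refl
    step-orbit [] [] (inj₂ (inj₁ refl)) = Orbits.orbit-sym σ-inj (1 , refl)
    step-orbit [] [] (inj₂ (inj₂ (inj₁ ())))
    step-orbit [] [] (inj₂ (inj₂ (inj₂ ())))
    step-orbit ((a , c) ∷ ts) (a↛c ∷ m) {x} {y} st = lift st
      where
      module M = Merge (twist-inj ts) a↛c
      lift : Step ((a , c) ∷ ts) x y → Orbit (twist ((a , c) ∷ ts)) x y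
      lift (inj₂ (inj₂ (inj₁ (here refl)))) = M.joined
      lift (inj₂ (inj₂ (inj₂ (here refl)))) = Orbits.orbit-sym (M.g-inj) M.joined
      lift (inj₁ e)                          = M.orbit-preserved (step-orbit ts m (inj₁ e))
      lift (inj₂ (inj₁ e))                   = M.orbit-preserved (step-orbit ts m (inj₂ (inj₁ e)))
      lift (inj₂ (inj₂ (inj₁ (there t))))    = M.orbit-preserved (step-orbit ts m (inj₂ (inj₂ (inj₁ t))))
      lift (inj₂ (inj₂ (inj₂ (there t))))    = M.orbit-preserved (step-orbit ts m (inj₂ (inj₂ (inj₂ t))))

    path-orbit : ∀ ts → Merging ts → ∀ {x y} → Star (Step ts) x y → Orbit (twist ts) x y
    path-orbit ts m ε = orbit-refl
    path-orbit ts m (s ◅ p) = orbit-trans (step-orbit ts m s) (path-orbit ts m p)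

    transpose-path : ∀ ts x → Star (Step ts) x (transpose ts x)
    transpose-path [] x = ε
    transpose-path ((a , c) ∷ ts) x with swap-cases a c x
    ... | inj₁ (refl , e) = inj₂ (inj₂ (inj₁ (here refl))) ◅
          subst (λ z → Star (Step ((x , c) ∷ ts)) c (transpose ts z)) (sym e) (Star.gmap id step-weaken (transpose-path ts c))
    ... | inj₂ (inj₁ (refl , e)) = inj₂ (inj₂ (inj₂ (here refl))) ◅
          subst (λ z → Star (Step ((a , x) ∷ ts)) a (transpose ts z)) (sym e) (Star.gmap id step-weaken (transpose-path ts a))
    ... | inj₂ (inj₂ e) =
          subst (λ z → Star (Step ((a , c) ∷ ts)) x (transpose ts z)) (sym e) (Star.gmap id step-weaken (transpose-path ts x))

    orbit-path : ∀ ts {x y} → Orbit (twist ts) x y → Star (Step ts) x y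
    orbit-path ts (zero , refl) = ε
    orbit-path ts (suc k , refl) = orbit-path ts (k , refl) ◅◅ transpose-path ts _ ◅◅ (inj₁ refl ◅ ε)

-- Darts of a map with b square-vertices, and transpositions inside squares

module Darts (b : ℕ) where

  square : Dart b → Fin b
  square = proj₁

  _≟ᵈ_ : DecidableEquality (Dart b)
  _≟ᵈ_ = ≡-dec Fin._≟_ Fin._≟_

  -- the ranking used by Defs is the position of the dart in the enumeration Fin (b * 4)
  dart-rank : Dart b → ℕ
  dart-rank (s , i) = toℕ s * 4 + toℕ i

  dart-rank-combine : ∀ s i → dart-rank (s , i) ≡ toℕ (Fin.combine s i)
  dart-rank-combine s i = trans (cong (_+ toℕ i) (*-comm (toℕ s) 4)) (sym (Finₚ.toℕ-combine s i))

  dart-rank-injective : ∀ {x y} → dart-rank x ≡ dart-rank y → x ≡ y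
  dart-rank-injective {s , i} {t , j} e with Finₚ.combine-injective s i t j
    (Finₚ.toℕ-injective (trans (sym (dart-rank-combine s i)) (trans e (dart-rank-combine t j))))
  ... | refl , refl = refl

  dart-rank< : ∀ x → dart-rank x < b * 4
  dart-rank< (s , i) = subst (_< b * 4) (sym (dart-rank-combine s i)) (Finₚ.toℕ<n (Fin.combine s i))

  darts-complete : ∀ x → x ∈ darts b
  darts-complete (s , i) = ∈-cartesianProduct⁺ (∈-allFin s) (∈-allFin i)

  open Permutations _≟ᵈ_ (darts b) (cartesianProduct⁺ (allFin⁺ b) (allFin⁺ 4)) darts-complete
                    (b * 4) dart-rank dart-rank-injective dart-rank< public

  Local : Fin b → List (Dart b × Dart b) → Set
  Local s = All (λ t → square (proj₁ t) ≡ s × square (proj₂ t) ≡ s)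

  local-avoids : ∀ {s t} i {ts} → Local t ts → s ≢ t → Avoids (s , i) ts
  local-avoids i [] s≢t = []
  local-avoids i ((in₁ , in₂) ∷ l) s≢t =
    ((λ e → s≢t (trans (cong square (sym e)) in₁)) , (λ e → s≢t (trans (cong square (sym e)) in₂))) ∷ local-avoids i l s≢t

  -- Transpositions (a , e) of two distinct inner vertices of one square such that no later
  -- transposition moves e.  In a tree each of them merges two cycles (see chain-merging).
  data SquareChain : List (Dart b × Dart b) → Set where
    []   : SquareChain []
    link : ∀ {a e ts} → a ≢ e → square a ≡ square e → Avoids e ts → SquareChain ts → SquareChain ((a , e) ∷ ts)

  chain-++ : ∀ {xs ys} → SquareChain xs → SquareChain ys → All (λ t → Avoids (proj₂ t) ys) xs → SquareChain (xs ++ ys)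
  chain-++ [] cy [] = cy
  chain-++ (link a≢e same av cx) cy (av′ ∷ avs) = link a≢e same (++⁺ av av′) (chain-++ cx cy avs)

  chain-same-square : ∀ {ts x y} → SquareChain ts → (x , y) ∈ ts → square x ≡ square y
  chain-same-square (link _ same _ _) (here refl) = same
  chain-same-square (link _ _ _ c)    (there m)   = chain-same-square c m

  module Blocks (block : Fin b → List (Dart b × Dart b)) (local : ∀ s → Local s (block s)) where

    blocks : List (Fin b) → List (Dart b × Dart b)
    blocks = concatMap block

    blocks-avoid : ∀ {s} i ss → All (s ≢_) ss → Avoids (s , i) (blocks ss)
    blocks-avoid i [] [] = []
    blocks-avoid i (t ∷ ss) (s≢t ∷ s∉ss) = ++⁺ (local-avoids i (local t) s≢t) (blocks-avoid i ss s∉ss)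

    transpose-blocks : (φ : Fin 4 → Fin 4) → (∀ s i → transpose (block s) (s , i) ≡ (s , φ i)) →
      ∀ ss → Unique ss → ∀ {s} i → s ∈ ss → transpose (blocks ss) (s , i) ≡ (s , φ i)
    transpose-blocks φ acts (s ∷ ss) (s∉ss ∷ _) i (here refl) = begin
      transpose (block s ++ blocks ss) (s , i)            ≡⟨ transpose-++ (block s) (blocks ss) (s , i) ⟩
      transpose (blocks ss) (transpose (block s) (s , i)) ≡⟨ cong (transpose (blocks ss)) (acts s i) ⟩
      transpose (blocks ss) (s , φ i)                     ≡⟨ transpose-fixes (blocks ss) (blocks-avoid (φ i) ss s∉ss) ⟩
      (s , φ i)                                           ∎
      where open ≡-Reasoning
    transpose-blocks φ acts (t ∷ ss) (t∉ss ∷ u) {s} i (there m) = begin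
      transpose (block t ++ blocks ss) (s , i)            ≡⟨ transpose-++ (block t) (blocks ss) (s , i) ⟩
      transpose (blocks ss) (transpose (block t) (s , i)) ≡⟨ cong (transpose (blocks ss)) (transpose-fixes (block t) (local-avoids i (local t) s≢t)) ⟩
      transpose (blocks ss) (s , i)                       ≡⟨ transpose-blocks φ acts ss u i m ⟩
      (s , φ i)                                           ∎
      where
      open ≡-Reasoning
      s≢t : s ≢ t
      s≢t refl = All.lookup t∉ss m refl

    length-blocks : ∀ m → (∀ s → length (block s) ≡ m) → ∀ ss → length (blocks ss) ≡ m * length ss
    length-blocks m len [] = sym (*-zeroʳ m)
    length-blocks m len (s ∷ ss) = begin
      length (block s ++ blocks ss)         ≡⟨ Listₚ.length-++ (block s) ⟩
      length (block s) + length (blocks ss) ≡⟨ cong₂ _+_ (len s) (length-blocks m len ss) ⟩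
      m + m * length ss                     ≡⟨ *-suc m (length ss) ⟨
      m * suc (length ss)                   ∎
      where open ≡-Reasoning

    chain-blocks : (∀ s → SquareChain (block s)) → ∀ ss → Unique ss → SquareChain (blocks ss)
    chain-blocks chain [] [] = []
    chain-blocks chain (s ∷ ss) (s∉ss ∷ u) = chain-++ (chain s) (chain-blocks chain ss u)
      (All.map (λ {t} (_ , in₂) → blocks-avoid (proj₂ (proj₂ t)) ss (subst (λ z → All (z ≢_) ss) (sym in₂) s∉ss)) (local s))

  length-allFin : ∀ n → length (allFin n) ≡ n
  length-allFin n = Listₚ.length-tabulate id

  i₀ i₁ i₂ i₃ : Fin 4
  i₀ = Fin.zero
  i₁ = Fin.suc Fin.zero
  i₂ = Fin.suc (Fin.suc Fin.zero)
  i₃ = Fin.suc (Fin.suc (Fin.suc Fin.zero))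

  inner≢ : ∀ {s : Fin b} {i j : Fin 4} → i ≢ j → (s , i) ≢ (s , j)
  inner≢ i≢j e = i≢j (cong proj₂ e)

  inner-edges : Color → Fin b → List (Dart b × Dart b)
  inner-edges c1 s = ((s , i₀) , (s , i₁)) ∷ ((s , i₂) , (s , i₃)) ∷ []
  inner-edges c2 s = ((s , i₁) , (s , i₂)) ∷ ((s , i₃) , (s , i₀)) ∷ []

  square-star : Fin b → List (Dart b × Dart b)
  square-star s = ((s , i₀) , (s , i₁)) ∷ ((s , i₀) , (s , i₂)) ∷ ((s , i₀) , (s , i₃)) ∷ []

  inner-local : ∀ c s → Local s (inner-edges c s)
  inner-local c1 s = (refl , refl) ∷ (refl , refl) ∷ []
  inner-local c2 s = (refl , refl) ∷ (refl , refl) ∷ []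

  star-local : ∀ s → Local s (square-star s)
  star-local s = (refl , refl) ∷ (refl , refl) ∷ (refl , refl) ∷ []

  inner-chain : ∀ c s → SquareChain (inner-edges c s)
  inner-chain c1 s = link (inner≢ λ ()) refl ((inner≢ (λ ()) , inner≢ (λ ())) ∷ []) (link (inner≢ λ ()) refl [] [])
  inner-chain c2 s = link (inner≢ λ ()) refl ((inner≢ (λ ()) , inner≢ (λ ())) ∷ []) (link (inner≢ λ ()) refl [] [])

  star-chain : ∀ s → SquareChain (square-star s)
  star-chain s =
    link (inner≢ λ ()) refl ((inner≢ (λ ()) , inner≢ (λ ())) ∷ (inner≢ (λ ()) , inner≢ (λ ())) ∷ [])
    (link (inner≢ λ ()) refl ((inner≢ (λ ()) , inner≢ (λ ())) ∷ [])
    (link (inner≢ λ ()) refl [] []))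

  pairing : Color → Fin 4 → Fin 4
  pairing c1 = pair₁
  pairing c2 = pair₂

  α-pairing : ∀ c (s : Fin b) i → α c (s , i) ≡ (s , pairing c i)
  α-pairing c1 s i = refl
  α-pairing c2 s i = refl

  module Apart (s : Fin b) where
    apart : ∀ (j k l : Fin 4) → l ≢ j → l ≢ k → swap (s , j) (s , k) (s , l) ≡ (s , l)
    apart j k l l≢j l≢k = swap-other (s , j) (s , k) (s , l) (inner≢ l≢j) (inner≢ l≢k)

  inner-acts : ∀ c s i → transpose (inner-edges c s) (s , i) ≡ (s , pairing c i)
  inner-acts c1 s = by-case
    where
    open Apart s
    by-case : ∀ i → swap (s , i₂) (s , i₃) (swap (s , i₀) (s , i₁) (s , i)) ≡ (s , pair₁ i)
    by-case Fin.zero = trans (cong (swap (s , i₂) (s , i₃)) (swap-left (s , i₀) (s , i₁))) (apart i₂ i₃ i₁ (λ ()) (λ ()))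
    by-case (Fin.suc Fin.zero) = trans (cong (swap (s , i₂) (s , i₃)) (swap-right (s , i₀) (s , i₁))) (apart i₂ i₃ i₀ (λ ()) (λ ()))
    by-case (Fin.suc (Fin.suc Fin.zero)) = trans (cong (swap (s , i₂) (s , i₃)) (apart i₀ i₁ i₂ (λ ()) (λ ()))) (swap-left (s , i₂) (s , i₃))
    by-case (Fin.suc (Fin.suc (Fin.suc Fin.zero))) = trans (cong (swap (s , i₂) (s , i₃)) (apart i₀ i₁ i₃ (λ ()) (λ ()))) (swap-right (s , i₂) (s , i₃))
  inner-acts c2 s = by-case
    where
    open Apart s
    by-case : ∀ i → swap (s , i₃) (s , i₀) (swap (s , i₁) (s , i₂) (s , i)) ≡ (s , pair₂ i)
    by-case Fin.zero = trans (cong (swap (s , i₃) (s , i₀)) (apart i₁ i₂ i₀ (λ ()) (λ ()))) (swap-right (s , i₃) (s , i₀))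
    by-case (Fin.suc Fin.zero) = trans (cong (swap (s , i₃) (s , i₀)) (swap-left (s , i₁) (s , i₂))) (apart i₃ i₀ i₂ (λ ()) (λ ()))
    by-case (Fin.suc (Fin.suc Fin.zero)) = trans (cong (swap (s , i₃) (s , i₀)) (swap-right (s , i₁) (s , i₂))) (apart i₃ i₀ i₁ (λ ()) (λ ()))
    by-case (Fin.suc (Fin.suc (Fin.suc Fin.zero))) = trans (cong (swap (s , i₃) (s , i₀)) (apart i₁ i₂ i₃ (λ ()) (λ ()))) (swap-left (s , i₃) (s , i₀))

  color-edges : Color → List (Dart b × Dart b)
  color-edges c = concatMap (inner-edges c) (allFin b)

  star-edges : List (Dart b × Dart b)
  star-edges = concatMap square-star (allFin b)

  color-edges-product : ∀ c d → transpose (color-edges c) d ≡ α c d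
  color-edges-product c (s , i) =
    trans (Blocks.transpose-blocks (inner-edges c) (inner-local c) (pairing c) (inner-acts c) (allFin b) (allFin⁺ b) i (∈-allFin s))
          (sym (α-pairing c s i))

  color-edges-length : ∀ c → length (color-edges c) ≡ 2 * b
  color-edges-length c = trans (Blocks.length-blocks (inner-edges c) (inner-local c) 2 (two c) (allFin b))
                               (cong (2 *_) (length-allFin b))
    where
    two : ∀ c s → length (inner-edges c s) ≡ 2
    two c1 s = refl
    two c2 s = refl

  star-edges-length : length star-edges ≡ 3 * b
  star-edges-length = trans (Blocks.length-blocks square-star star-local 3 (λ _ → refl) (allFin b))
                            (cong (3 *_) (length-allFin b))

  color-chain : ∀ c → SquareChain (color-edges c)
  color-chain c = Blocks.chain-blocks (inner-edges c) (inner-local c) (inner-chain c) (allFin b) (allFin⁺ b)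

  star-chain-all : SquareChain star-edges
  star-chain-all = Blocks.chain-blocks square-star star-local star-chain (allFin b) (allFin⁺ b)

  star-member : ∀ s {t} → t ∈ square-star s → t ∈ star-edges
  star-member s m = ∈-concatMap⁺ square-star (Any.map (λ { refl → m }) (∈-allFin s))

-- Cycle counts of a square map

module Counts (T : SquareMap) where
  open SquareMap T using (nV; b; end; σ; σ-preserves; σ-cyclic; connected; IsTree; isolated)
  open Darts b

  next : Dart b → Dart b
  next = Inverse.to σ

  next-inj : Injective next
  next-inj {x} {y} e = begin
    x                         ≡⟨ Inverse.strictlyInverseʳ σ x ⟨
    Inverse.from σ (next x)   ≡⟨ cong (Inverse.from σ) e ⟩
    Inverse.from σ (next y)   ≡⟨ Inverse.strictlyInverseʳ σ y ⟩
    y                         ∎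
    where open ≡-Reasoning

  open Products next next-inj
  private module N = Orbits next-inj

  Edge : (Fin nV ⊎ Fin b) → (Fin nV ⊎ Fin b) → Set
  Edge = Adj end (λ _ → ⊤)

  EdgeAvoiding : Dart b → (Fin nV ⊎ Fin b) → (Fin nV ⊎ Fin b) → Set
  EdgeAvoiding e = Adj end (λ d → d ≢ e)

  -- Steps along `next` stay at a black vertex, and a transposition inside a square is a path
  -- through that square; if none of the transpositions touches e, the edge at e is not used.
  step-paths : ∀ {e ts} → SquareChain ts → Avoids e ts →
               ∀ {x y} → Star (Step ts) x y → Star (EdgeAvoiding e) (inj₁ (end x)) (inj₁ (end y))
  step-paths ch av ε = ε
  step-paths {e} ch av {x} {y} (inj₁ refl ◅ p) =
    subst (λ v → Star (EdgeAvoiding e) (inj₁ v) (inj₁ (end y))) (σ-preserves x) (step-paths ch av p)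
  step-paths {e} ch av {x} {y} (inj₂ (inj₁ refl) ◅ p) =
    subst (λ v → Star (EdgeAvoiding e) (inj₁ v) (inj₁ (end y))) (sym (σ-preserves _)) (step-paths ch av p)
  step-paths ch av {x} (inj₂ (inj₂ (inj₁ m)) ◅ p) with All.lookup av m
  ... | x≢e , z≢e = (x , x≢e , inj₁ (refl , refl)) ◅ (_ , z≢e , inj₂ (cong inj₂ (chain-same-square ch m) , refl))
                    ◅ step-paths ch av p
  step-paths ch av {x} (inj₂ (inj₂ (inj₂ m)) ◅ p) with All.lookup av m
  ... | z≢e , x≢e = (x , x≢e , inj₁ (refl , refl)) ◅ (_ , z≢e , inj₂ (cong inj₂ (sym (chain-same-square ch m)) , refl))
                    ◅ step-paths ch av p

  edge-sym : ∀ {ok : Dart b → Set} {x y} → Adj end ok x y → Adj end ok y x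
  edge-sym (d , o , inj₁ (p , q)) = d , o , inj₂ (q , p)
  edge-sym (d , o , inj₂ (p , q)) = d , o , inj₁ (q , p)

  reroute : ∀ {e} → Star (EdgeAvoiding e) (inj₂ (square e)) (inj₁ (end e)) →
            ∀ {x y} → Star Edge x y → Star (EdgeAvoiding e) x y
  reroute detour ε = ε
  reroute {e} detour ((d , _ , dir) ◅ p) with d ≟ᵈ e
  ... | no d≢e = (d , d≢e , dir) ◅ reroute detour p
  reroute detour ((d , _ , inj₁ (refl , refl)) ◅ p) | yes refl = Star.reverse edge-sym detour ◅◅ reroute detour p
  reroute detour ((d , _ , inj₂ (refl , refl)) ◅ p) | yes refl = detour ◅◅ reroute detour p

  -- In a tree, the black ends of two distinct inner vertices a, e of one square cannot be joined
  -- without the edge at e: together with the edge at a that would leave the edge at e a non-bridge.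
  tree-separates : IsTree → ∀ {a e} → a ≢ e → square a ≡ square e →
                   ¬ Star (EdgeAvoiding e) (inj₁ (end a)) (inj₁ (end e))
  tree-separates tree {a} {e} a≢e same p =
    tree e (proj₁ connected , λ x y → reroute detour (proj₂ connected x y))
    where
    detour : Star (EdgeAvoiding e) (inj₂ (square e)) (inj₁ (end e))
    detour = (a , a≢e , inj₂ (cong inj₂ (sym same) , refl)) ◅ p

  chain-merging : IsTree → ∀ {ts} → SquareChain ts → Merging ts
  chain-merging tree [] = []
  chain-merging tree (link a≢e same av ch) =
    (λ o → tree-separates tree a≢e same (step-paths ch av (orbit-path _ o))) ∷ chain-merging tree ch

  face-cycles : IsTree → ∀ c → cycles (next ∘ α c) + 2 * b ≡ cycles next
  face-cycles tree c = begin
    cycles (next ∘ α c) + 2 * b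
      ≡⟨ cong₂ _+_ (cycles-cong (λ d → cong next (sym (color-edges-product c d)))) (sym (color-edges-length c)) ⟩
    cycles (twist (color-edges c)) + length (color-edges c)
      ≡⟨ cycles-twist _ (chain-merging tree (color-chain c)) ⟩
    cycles next
      ∎
    where open ≡-Reasoning

  star-cycles : IsTree → cycles (twist star-edges) + 3 * b ≡ cycles next
  star-cycles tree = trans (cong (cycles (twist star-edges) +_) (sym star-edges-length))
                           (cycles-twist _ (chain-merging tree star-chain-all))

  around-vertex : ∀ {ts x y} → end x ≡ end y → Star (Step ts) x y
  around-vertex {ts} {x} same with σ-cyclic x _ same
  ... | k , refl = iterates k
    where
    iterates : ∀ k → Star (Step ts) x (iter next k x)
    iterates zero = ε
    iterates (suc k) = iterates k ◅◅ (inj₁ refl ◅ ε)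

  to-corner : ∀ s i → Star (Step star-edges) (s , i) (s , i₀)
  to-corner s Fin.zero = ε
  to-corner s (Fin.suc Fin.zero) = inj₂ (inj₂ (inj₂ (star-member s (here refl)))) ◅ ε
  to-corner s (Fin.suc (Fin.suc Fin.zero)) = inj₂ (inj₂ (inj₂ (star-member s (there (here refl))))) ◅ ε
  to-corner s (Fin.suc (Fin.suc (Fin.suc Fin.zero))) = inj₂ (inj₂ (inj₂ (star-member s (there (there (here refl)))))) ◅ ε

  within-square : ∀ {x y} → square x ≡ square y → Star (Step star-edges) x y
  within-square {s , i} {s , j} refl = to-corner s i ◅◅ Star.reverse step-sym (to-corner s j)

  At : (Fin nV ⊎ Fin b) → Dart b → Set
  At (inj₁ v) d = end d ≡ v
  At (inj₂ s) d = square d ≡ s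

  at-same : ∀ u {x y} → At u x → At u y → Star (Step star-edges) x y
  at-same (inj₁ v) p q = around-vertex (trans p (sym q))
  at-same (inj₂ s) p q = within-square (trans p (sym q))

  path-steps : ∀ {u w} → Star Edge u w → ∀ {x y} → At u x → At w y → Star (Step star-edges) x y
  path-steps {u} ε p q = at-same u p q
  path-steps {u} ((d , _ , inj₁ (refl , refl)) ◅ r) p q = at-same u p refl ◅◅ path-steps r refl q
  path-steps {u} ((d , _ , inj₂ (refl , refl)) ◅ r) p q = at-same u p refl ◅◅ path-steps r refl q

  star-transitive : IsTree → ∀ x y → Orbit (twist star-edges) x y
  star-transitive tree x y =
    path-orbit _ (chain-merging tree star-chain-all) (path-steps (proj₂ connected (inj₁ (end x)) (inj₁ (end y))) refl refl)

  -- Counting vertices: each non-isolated black vertex carries exactly one cycle of next.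

  hits : Dart b → Fin nV → Bool
  hits d v = ⌊ end d Fin.≟ v ⌋

  hits-self : ∀ d → hits d (end d) ≡ true
  hits-self d = ⌊⌋-true (end d Fin.≟ end d) refl

  hits-sound : ∀ d v → hits d v ≡ true → end d ≡ v
  hits-sound d v h with end d Fin.≟ v
  ... | yes e = e

  isolated? : Fin nV → Bool
  isolated? v = all (λ d → not (hits d v)) (darts b)

  vertex-contribution : ∀ v → count (λ d → isMin? next d ∧ hits d v) (darts b) + indicator (isolated? v) ≡ 1
  vertex-contribution v with isolated? v in iso
  ... | true = cong (_+ 1) (count-none (darts b) no-dart)
    where
    no-dart : ∀ {d} → d ∈ darts b → (isMin? next d ∧ hits d v) ≡ false
    no-dart {d} m with hits d v | all-sound _ (darts b) iso m
    ... | true  | ()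
    ... | false | _ = ∧-zeroʳ (isMin? next d)
  ... | false with all-witness _ (darts b) iso
  ...   | d , _ , hit with N.orbit-min d
  ...     | m , d→m , m-min = cong (_+ 0) (count-one (darts b) (cartesianProduct⁺ (allFin⁺ b) (allFin⁺ 4))
                                  (darts-complete m) m-counts others)
    where
    end-on-orbit : ∀ {x y} → Orbit next x y → end y ≡ end x
    end-on-orbit (zero , refl) = refl
    end-on-orbit (suc k , refl) = trans (σ-preserves _) (end-on-orbit (k , refl))
    m-at-v : end m ≡ v
    m-at-v = trans (end-on-orbit d→m) (hits-sound d v (not-false hit))
      where
      not-false : ∀ {c} → not c ≡ false → c ≡ true
      not-false {true} _ = refl
    m-counts : (isMin? next m ∧ hits m v) ≡ true
    m-counts rewrite N.isMin?-complete m m-min | sym m-at-v = hits-self m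
    others : ∀ x → x ≢ m → (isMin? next x ∧ hits x v) ≡ false
    others x x≢m with isMin? next x in minimal | hits x v in at-v
    ... | false | _     = refl
    ... | true  | false = refl
    ... | true  | true  = ⊥-elim (x≢m (N.min-unique (N.isMin?-sound x minimal) m-min
                            (σ-cyclic x m (trans (hits-sound x v at-v) (sym m-at-v)))))

  vertex-count : cycles next + isolated ≡ nV
  vertex-count = begin
    cycles next + isolated
      ≡⟨ cong₂ _+_ (count-fibres end (isMin? next) (darts b)) (count-as-sum isolated? (allFin nV)) ⟩
    sum (λ v → count (λ d → isMin? next d ∧ hits d v) (darts b)) (allFin nV) + sum (indicator ∘ isolated?) (allFin nV)
      ≡⟨ sum-+ _ _ (allFin nV) ⟨
    sum (λ v → count (λ d → isMin? next d ∧ hits d v) (darts b) + indicator (isolated? v)) (allFin nV)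
      ≡⟨ sum-cong (allFin nV) vertex-contribution ⟩
    sum (λ _ → 1) (allFin nV)
      ≡⟨ sum-const-1 (allFin nV) ⟩
    length (allFin nV)
      ≡⟨ length-allFin nV ⟩
    nV
      ∎
    where open ≡-Reasoning

  first-dart : ∀ {x y} → Star Edge x y → ∀ {v s} → x ≡ inj₁ v → y ≡ inj₂ s → ∃ λ d → end d ≡ v
  first-dart ε refl ()
  first-dart ((d , _ , inj₁ (refl , _)) ◅ _) refl _ = d , refl
  first-dart ((d , _ , inj₂ (() , _)) ◅ _) refl _

  single-vertex : (Dart b → ⊥) → nV ≡ 1
  single-vertex no-dart with proj₁ connected
  ... | inj₂ s = ⊥-elim (no-dart (s , i₀))
  ... | inj₁ v₀ = only v₀ λ v → inj₁-injective (no-edges (proj₂ connected (inj₁ v) (inj₁ v₀)))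
    where
    no-edges : ∀ {x y} → Star Edge x y → x ≡ y
    no-edges ε = refl
    no-edges ((d , _) ◅ _) = ⊥-elim (no-dart d)
    inj₁-injective : ∀ {v w : Fin nV} → inj₁ {B = Fin b} v ≡ inj₁ w → v ≡ w
    inj₁-injective refl = refl
    only : ∀ {n} (v₀ : Fin n) → (∀ v → v ≡ v₀) → n ≡ 1
    only {suc zero} v₀ all-v₀ = refl
    only {suc (suc n)} v₀ all-v₀ with trans (all-v₀ Fin.zero) (sym (all-v₀ (Fin.suc Fin.zero)))
    ... | ()

  one-face : IsTree → cycles (twist star-edges) + isolated ≡ 1
  one-face tree = by-squares (zero-or-fin b)
    where
    zero-or-fin : ∀ n → n ≡ 0 ⊎ Fin n
    zero-or-fin zero = inj₁ refl
    zero-or-fin (suc n) = inj₂ Fin.zero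
    by-squares : b ≡ 0 ⊎ Fin b → cycles (twist star-edges) + isolated ≡ 1
    by-squares (inj₂ s) = cong₂ _+_ (Twisted.cycles-transitive (star-transitive tree) (s , i₀)) no-isolated
      where
      module Twisted = Orbits (twist-inj star-edges)
      no-isolated : isolated ≡ 0
      no-isolated = count-none (allFin nV) λ {v} _ →
        let (d , at-v) = first-dart (proj₂ connected (inj₁ v) (inj₂ s)) refl refl in
        all-refute _ (darts b) (darts-complete d) (cong not (subst (λ w → hits d w ≡ true) at-v (hits-self d)))
    by-squares (inj₁ no-squares) = cong₂ _+_ no-cycles all-isolated
      where
      no-dart : Dart b → ⊥
      no-dart (s , _) with subst Fin no-squares s
      ... | ()
      no-cycles : cycles (twist star-edges) ≡ 0
      no-cycles = count-none (darts b) (λ {d} _ → ⊥-elim (no-dart d))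
      all-isolated : isolated ≡ 1
      all-isolated = begin
        count isolated? (allFin nV) ≡⟨ count-all (allFin nV) (λ _ → all-complete _ (darts b) (λ {d} _ → ⊥-elim (no-dart d))) ⟩
        length (allFin nV)          ≡⟨ length-allFin nV ⟩
        nV                          ≡⟨ single-vertex no-dart ⟩
        1                           ∎
        where open ≡-Reasoning

face-arithmetic : ∀ {c₁ c₂ c★ C i n b : ℕ} → c₁ + 2 * b ≡ C → c₂ + 2 * b ≡ C → c★ + 3 * b ≡ C →
                  c★ + i ≡ 1 → C + i ≡ n → c₁ + i + (c₂ + i) + n ≡ 5 * b + 3
face-arithmetic {c₁} {c₂} {c★} {C} {i} {n} {b} e₁ e₂ e★ one refl = begin
  c₁ + i + (c₂ + i) + (C + i)
    ≡⟨ cong₂ (λ x y → x + i + (y + i) + (C + i)) (drop-2b {c₁} e₁) (drop-2b {c₂} e₂) ⟩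
  c★ + b + i + (c★ + b + i) + (C + i)
    ≡⟨ cong (λ x → c★ + b + i + (c★ + b + i) + (x + i)) (sym e★) ⟩
  c★ + b + i + (c★ + b + i) + (c★ + 3 * b + i)
    ≡⟨ solve 3 (λ c i b → c :+ b :+ i :+ (c :+ b :+ i) :+ (c :+ con 3 :* b :+ i) := con 5 :* b :+ con 3 :* (c :+ i))
             refl c★ i b ⟩
  5 * b + 3 * (c★ + i)
    ≡⟨ cong (λ x → 5 * b + 3 * x) one ⟩
  5 * b + 3
    ∎
  where
  open ≡-Reasoning
  open +-*-Solver
  drop-2b : ∀ {c} → c + 2 * b ≡ C → c ≡ c★ + b
  drop-2b {c} e = +-cancelʳ-≡ (2 * b) c (c★ + b)
    (trans e (trans (sym e★) (solve 2 (λ c b → c :+ con 3 :* b := c :+ b :+ con 2 :* b) refl c★ b)))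

proposition2 : (T : SquareMap) → SquareMap.IsTree T → SquareMap.F T ≡ 5 * SquareMap.b T + 3
proposition2 T tree =
  face-arithmetic {c₁ = cycles (next ∘ α c1)} {c₂ = cycles (next ∘ α c2)} {b = SquareMap.b T}
    (face-cycles tree c1)
    (face-cycles tree c2)
    (star-cycles tree)
    (one-face tree)
    vertex-count
  where
  open Counts T
  open Darts (SquareMap.b T) using (cycles)
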